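{- For all integers $n>1$, \[3\log_3 n \leq \|n\|_{ - } \leq 6\log_6 n + 5.890 < 3.679\log_3 n + 5.890.\] Moreover, if $n$ is a power of $3$ then $\|n\|_{ - } = 3\log_3 n$, and otherwise $\|n\|_{ - } > 3\log_3 n$.
   Context: For a positive integer $m$, $\|m\|_{ - }$ denotes the minimum number of occurrences of the constant $1$ in an arithmetic expression built only from the constant $1$, addition, multiplication, subtraction and parentheses (the basis $\{1,+,\cdot,-\}$) whose value is $m$. -}

module Defs where

open import Data.Nat using (ℕ; _+_; _≤_)
open import Data.Integer as ℤ using (ℤ; +_)
open import Data.Product using (Σ; _×_)
open import Relation.Binary.PropositionalEquality using (_≡_)

data Expr : Set where
  one : Expr
  _⊕_ : Expr → Expr → Expr
  _⊗_ : Expr → Expr → Expr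
  _⊖_ : Expr → Expr → Expr

eval : Expr → ℤ
eval one = + 1
eval (e ⊕ f) = eval e ℤ.+ eval f
eval (e ⊗ f) = eval e ℤ.* eval f
eval (e ⊖ f) = eval e ℤ.- eval f

ones : Expr → ℕ
ones one = 1
ones (e ⊕ f) = ones e + ones f
ones (e ⊗ f) = ones e + ones f
ones (e ⊖ f) = ones e + ones f

IsNorm : ℕ → ℕ → Set
IsNorm m k = Σ Expr (λ e → eval e ≡ + m × ones e ≡ k)
           × ((e : Expr) → eval e ≡ + m → k ≤ ones e)

{-# OPTIONS --safe #-}
-- Lower bound: by induction on an expression, |value|³ ≤ 3 ^ (number of ones).
-- Products are multiplicative, and for sums and differences (x + y)³ ≤ 3 ^ (a + b)
-- follows from x³ ≤ 3 ^ a and y³ ≤ 3 ^ b because either a summand is at most 2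
-- or x + y ≤ x y.  Equality n³ = 3 ^ k forces n to be a power of 3, and
-- 3 ^ m = 3 · 3 ⋯ 3 uses exactly 3 m ones.
-- Upper bound: every n ≥ 4 is 6 q + d with q ≥ 1 and −2 ≤ d ≤ 3, and is obtained
-- from an expression for q with six more ones (6 q − 2 = 2 (3 q − 1), …,
-- 6 q + 3 = 3 (2 q + 1)).  Since 5 n − 2 ≥ 6 (5 q − 2), induction gives
-- 6 ^ (k / 6) ≤ C · (5 n − 2) / 5, the constant C being checked on n ≤ 3.
-- The minimum defining ‖n‖₋ exists because expressions with at most s ones
-- have depth at most s, so they can be searched exhaustively.
module Submission where

open import Defs
open import Data.Nat using (ℕ; _+_; _*_; _^_; _≤_; _<_)
open import Data.Product using (Σ; _×_)
open import Relation.Binary.PropositionalEquality using (_≡_)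
open import Relation.Nullary using (¬_)
open import Data.Nat using (zero; suc; z≤n; s≤s; _≤?_; _≟_; anyUpTo?)
open import Data.Nat.Properties
open import Data.Nat.Divisibility using (_∣_; divides)
open import Data.Nat.Primality using (Prime; prime?; euclidsLemma)
open import Data.Nat.DivMod using (_/_; _%_; m≡m%n+[m/n]*n; m%n<n; m/n≤m)
open import Data.Nat.Induction using (<-rec)
open import Data.Nat.Tactic.RingSolver using (solve-∀)
open import Data.Integer as ℤ using (+_; ∣_∣)
import Data.Integer.Properties as ℤP
import Data.Integer.Tactic.RingSolver as ℤSolver
open import Algebra.Properties.AbelianGroup ℤP.+-0-abelianGroup using (∙-cancelʳ)
open import Data.Product using (∃-syntax; _,_)
open import Data.Sum using (inj₁; inj₂)
open import Data.Empty using (⊥-elim)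
open import Data.Unit using (tt)
open import Relation.Binary.PropositionalEquality using (refl; sym; trans; cong; subst; subst₂; module ≡-Reasoning)
open import Relation.Nullary using (Dec; yes; no)
open import Relation.Nullary.Decidable using (toWitness; map′; _×-dec_; _⊎-dec_)
open import Relation.Unary using (Pred; Decidable)
open import Level using (0ℓ)

ones-positive : ∀ e → 1 ≤ ones e
ones-positive one = s≤s z≤n
ones-positive (e ⊕ f) = ≤-trans (ones-positive e) (m≤m+n _ _)
ones-positive (e ⊗ f) = ≤-trans (ones-positive e) (m≤m+n _ _)
ones-positive (e ⊖ f) = ≤-trans (ones-positive e) (m≤m+n _ _)

^-distribʳ-* : ∀ m n o → (m * n) ^ o ≡ m ^ o * n ^ o
^-distribʳ-* m n zero = refl
^-distribʳ-* m n (suc o) rewrite ^-distribʳ-* m n o = interchange m n (m ^ o) (n ^ o)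
  where
  interchange : ∀ a b x y → a * b * (x * y) ≡ a * x * (b * y)
  interchange = solve-∀

suc-cube-≤ : ∀ y {b} → 1 ≤ b → y ^ 3 ≤ 3 ^ b → (1 + y) ^ 3 ≤ 3 * 3 ^ b
suc-cube-≤ 0 {b} _ _ = m^n>0 3 (suc b)
suc-cube-≤ 1 hb _ = ≤-trans (toWitness {a? = 8 ≤? 9} tt) (*-monoʳ-≤ 3 (^-monoʳ-≤ 3 hb))
suc-cube-≤ 2 {suc (suc b)} _ _ = *-monoʳ-≤ 3 (^-monoʳ-≤ 3 {2} {2 + b} (s≤s (s≤s z≤n)))
suc-cube-≤ 2 {0} () _
suc-cube-≤ 2 {1} _ (s≤s (s≤s (s≤s ())))
suc-cube-≤ (suc (suc (suc t))) _ hy =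
  ≤-trans (subst ((4 + t) ^ 3 ≤_) (expand t) (m≤m+n _ _)) (*-monoʳ-≤ 3 hy)
  where
  -- 3 (3 + t)³ − (4 + t)³ has nonnegative coefficients.
  expand : ∀ t → (4 + t) * ((4 + t) * ((4 + t) * 1)) + (17 + 33 * t + 15 * (t * t) + 2 * (t * t * t))
                 ≡ 3 * ((3 + t) * ((3 + t) * ((3 + t) * 1)))
  expand = solve-∀

cube-+-≤ : ∀ x y {a b} → 1 ≤ a → 1 ≤ b → x ^ 3 ≤ 3 ^ a → y ^ 3 ≤ 3 ^ b → (x + y) ^ 3 ≤ 3 ^ (a + b)
cube-+-≤ 0 _ {a} {b} _ _ _ hy = ≤-trans hy (^-monoʳ-≤ 3 (m≤n+m b a))
cube-+-≤ (suc x) 0 {a} {b} _ _ hx _ rewrite +-identityʳ x = ≤-trans hx (^-monoʳ-≤ 3 (m≤m+n a b))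
cube-+-≤ 1 (suc y) {a} {b} ha hb _ hy =
  ≤-trans (suc-cube-≤ (suc y) hb hy) (^-monoʳ-≤ 3 (+-monoˡ-≤ b ha))
cube-+-≤ (suc (suc x)) 1 {a} {b} ha hb hx hy =
  subst₂ (λ u v → u ^ 3 ≤ 3 ^ v) (+-comm 1 (2 + x)) (+-comm b a) (cube-+-≤ 1 (2 + x) hb ha hy hx)
cube-+-≤ (suc (suc s)) (suc (suc t)) {a} {b} _ _ hx hy = begin
  (x + y) ^ 3        ≤⟨ ^-monoˡ-≤ 3 (subst (x + y ≤_) (sum-le-product s t) (m≤m+n _ _)) ⟩
  (x * y) ^ 3        ≡⟨ ^-distribʳ-* x y 3 ⟩
  x ^ 3 * y ^ 3      ≤⟨ *-mono-≤ hx hy ⟩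
  3 ^ a * 3 ^ b      ≡⟨ ^-distribˡ-+-* 3 a b ⟨
  3 ^ (a + b)        ∎
  where
  open ≤-Reasoning
  x = 2 + s
  y = 2 + t
  sum-le-product : ∀ s t → (2 + s) + (2 + t) + (s + t + s * t) ≡ (2 + s) * (2 + t)
  sum-le-product = solve-∀

∣eval∣-cube-≤ : ∀ e → ∣ eval e ∣ ^ 3 ≤ 3 ^ ones e
∣eval∣-cube-≤ one = s≤s z≤n
∣eval∣-cube-≤ (e ⊕ f) =
  ≤-trans (^-monoˡ-≤ 3 (ℤP.∣i+j∣≤∣i∣+∣j∣ (eval e) (eval f)))
          (cube-+-≤ ∣ eval e ∣ ∣ eval f ∣ (ones-positive e) (ones-positive f) (∣eval∣-cube-≤ e) (∣eval∣-cube-≤ f))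
∣eval∣-cube-≤ (e ⊖ f) =
  ≤-trans (^-monoˡ-≤ 3 (ℤP.∣i-j∣≤∣i∣+∣j∣ (eval e) (eval f)))
          (cube-+-≤ ∣ eval e ∣ ∣ eval f ∣ (ones-positive e) (ones-positive f) (∣eval∣-cube-≤ e) (∣eval∣-cube-≤ f))
∣eval∣-cube-≤ (e ⊗ f)
  rewrite ℤP.abs-* (eval e) (eval f) | ^-distribʳ-* ∣ eval e ∣ ∣ eval f ∣ 3 | ^-distribˡ-+-* 3 (ones e) (ones f)
  = *-mono-≤ (∣eval∣-cube-≤ e) (∣eval∣-cube-≤ f)

prime-3 : Prime 3
prime-3 = toWitness {a? = prime? 3} tt

3∣cube⇒3∣ : ∀ n → 3 ∣ n ^ 3 → 3 ∣ n
3∣cube⇒3∣ n h with euclidsLemma n (n ^ 2) prime-3 h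
... | inj₁ 3∣n = 3∣n
... | inj₂ 3∣n² with euclidsLemma n (n ^ 1) prime-3 3∣n²
...   | inj₁ 3∣n = 3∣n
...   | inj₂ 3∣n¹ = subst (3 ∣_) (*-identityʳ n) 3∣n¹

cube≡3^⇒≡3^ : ∀ k n → n ^ 3 ≡ 3 ^ k → ∃[ m ] n ≡ 3 ^ m
cube≡3^⇒≡3^ zero n eq with m^n≡1⇒n≡0∨m≡1 n 3 eq
... | inj₂ n≡1 = 0 , n≡1
cube≡3^⇒≡3^ (suc k) n eq with 3∣cube⇒3∣ n (divides (3 ^ k) (trans eq (*-comm 3 (3 ^ k))))
... | divides c refl = from-third k c (*-cancelˡ-≡ (3 * (3 * c ^ 3)) (3 ^ k) 3 (trans (sym (triple-cube c)) eq))
  where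
  triple-cube : ∀ c → (c * 3) * ((c * 3) * ((c * 3) * 1)) ≡ 3 * (3 * (3 * (c * (c * (c * 1)))))
  triple-cube = solve-∀
  from-third : ∀ k c → 3 * (3 * c ^ 3) ≡ 3 ^ k → ∃[ m ] c * 3 ≡ 3 ^ m
  from-third zero c eq with () ← m*n≡1⇒m≡1 3 (3 * c ^ 3) eq
  from-third (suc zero) c eq with () ← m*n≡1⇒m≡1 3 (c ^ 3) (*-cancelˡ-≡ (3 * c ^ 3) 1 3 eq)
  from-third (suc (suc k)) c eq
    with cube≡3^⇒≡3^ k c (*-cancelˡ-≡ (c ^ 3) (3 ^ k) 3 (*-cancelˡ-≡ (3 * c ^ 3) (3 * 3 ^ k) 3 eq))
  ... | m , refl = suc m , *-comm (3 ^ m) 3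

data DepthBelow : ℕ → Expr → Set where
  one : ∀ {s} → DepthBelow (suc s) one
  _⊕_ : ∀ {s e f} → DepthBelow s e → DepthBelow s f → DepthBelow (suc s) (e ⊕ f)
  _⊗_ : ∀ {s e f} → DepthBelow s e → DepthBelow s f → DepthBelow (suc s) (e ⊗ f)
  _⊖_ : ∀ {s e f} → DepthBelow s e → DepthBelow s f → DepthBelow (suc s) (e ⊖ f)

+-≤-suc⇒both-≤ : ∀ {m n s} → 1 ≤ m → 1 ≤ n → m + n ≤ suc s → m ≤ s × n ≤ s
+-≤-suc⇒both-≤ {m} {n} 1≤m 1≤n h =
  ≤-pred (≤-trans (≤-reflexive (+-comm 1 m)) (≤-trans (+-monoʳ-≤ m 1≤n) h)) ,
  ≤-pred (≤-trans (+-monoˡ-≤ n 1≤m) h)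

ones≤⇒depthBelow : ∀ s e → ones e ≤ s → DepthBelow s e
ones≤⇒depthBelow zero e h with () ← ≤-trans (ones-positive e) h
ones≤⇒depthBelow (suc s) one _ = one
ones≤⇒depthBelow (suc s) (e ⊕ f) h with +-≤-suc⇒both-≤ (ones-positive e) (ones-positive f) h
... | he , hf = ones≤⇒depthBelow s e he ⊕ ones≤⇒depthBelow s f hf
ones≤⇒depthBelow (suc s) (e ⊗ f) h with +-≤-suc⇒both-≤ (ones-positive e) (ones-positive f) h
... | he , hf = ones≤⇒depthBelow s e he ⊗ ones≤⇒depthBelow s f hf
ones≤⇒depthBelow (suc s) (e ⊖ f) h with +-≤-suc⇒both-≤ (ones-positive e) (ones-positive f) h
... | he , hf = ones≤⇒depthBelow s e he ⊖ ones≤⇒depthBelow s f hf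

any-depthBelow? : ∀ s {P : Pred Expr 0ℓ} → Decidable P → Dec (∃[ e ] DepthBelow s e × P e)
any-depthBelow? zero P? = no λ { (_ , () , _) }
any-depthBelow? (suc s) {P} P? with P? one
... | yes p = yes (one , one , p)
... | no ¬p with any-depthBelow? s (λ e → any-depthBelow? s (λ f → P? (e ⊕ f) ⊎-dec P? (e ⊗ f) ⊎-dec P? (e ⊖ f)))
...   | yes (e , de , f , df , inj₁ p) = yes (e ⊕ f , de ⊕ df , p)
...   | yes (e , de , f , df , inj₂ (inj₁ p)) = yes (e ⊗ f , de ⊗ df , p)
...   | yes (e , de , f , df , inj₂ (inj₂ p)) = yes (e ⊖ f , de ⊖ df , p)
...   | no ¬q = no λ { (one , _ , p) → ¬p p
                     ; (e ⊕ f , de ⊕ df , p) → ¬q (e , de , f , df , inj₁ p)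
                     ; (e ⊗ f , de ⊗ df , p) → ¬q (e , de , f , df , inj₂ (inj₁ p))
                     ; (e ⊖ f , de ⊖ df , p) → ¬q (e , de , f , df , inj₂ (inj₂ p)) }

Least : Pred ℕ 0ℓ → ℕ → Set
Least P k = P k × (∀ {j} → j < k → ¬ P j)

least-witness : ∀ {P : Pred ℕ 0ℓ} → Decidable P → ∀ u → P u → ∃[ k ] Least P k
least-witness {P} P? = <-rec _ go
  where
  go : ∀ u → (∀ {j} → j < u → P j → ∃[ k ] Least P k) → P u → ∃[ k ] Least P k
  go u rec pu with anyUpTo? P? u
  ... | yes (j , j<u , pj) = rec j<u pj
  ... | no none = u , pu , λ j<u pj → none (_ , j<u , pj)

Achieves : ℕ → ℕ → Set
Achieves n k = ∃[ e ] ones e ≡ k × eval e ≡ + n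

achieves? : ∀ n → Decidable (Achieves n)
achieves? n k =
  map′ (λ (e , _ , p) → e , p)
       (λ (e , p@(ones≡k , _)) → e , ones≤⇒depthBelow k e (≤-reflexive ones≡k) , p)
       (any-depthBelow? k (λ e → (ones e ≟ k) ×-dec (eval e ℤP.≟ + n)))

norm-exists : ∀ n e → eval e ≡ + n → ∃[ k ] IsNorm n k
norm-exists n e eval≡n with least-witness (achieves? n) (ones e) (e , refl , eval≡n)
... | k , (e₀ , ones≡k , eval₀≡n) , below = k , (e₀ , eval₀≡n , ones≡k) , minimal
  where
  minimal : ∀ f → eval f ≡ + n → k ≤ ones f
  minimal f eval≡n = ≮⇒≥ (λ lt → below lt (f , refl , eval≡n))

two three : Expr
two = one ⊕ one
three = two ⊕ one

digit : ℕ → Expr → Expr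
digit 0 q = two ⊗ ((three ⊗ q) ⊖ one)
digit 1 q = (two ⊗ (three ⊗ q)) ⊖ one
digit 2 q = two ⊗ (three ⊗ q)
digit 3 q = (two ⊗ (three ⊗ q)) ⊕ one
digit 4 q = two ⊗ ((three ⊗ q) ⊕ one)
digit (suc (suc (suc (suc (suc _))))) q = three ⊗ ((two ⊗ q) ⊕ one)

ones-digit : ∀ r q → ones (digit r q) ≤ 6 + ones q
ones-digit 0 q = ≤-reflexive (cong (_+_ 5) (+-comm (ones q) 1))
ones-digit 1 q = ≤-reflexive (cong (_+_ 5) (+-comm (ones q) 1))
ones-digit 2 q = n≤1+n (5 + ones q)
ones-digit 3 q = ≤-reflexive (cong (_+_ 5) (+-comm (ones q) 1))
ones-digit 4 q = ≤-reflexive (cong (_+_ 5) (+-comm (ones q) 1))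
ones-digit (suc (suc (suc (suc (suc _))))) q = ≤-reflexive (cong (_+_ 5) (+-comm (ones q) 1))

eval-digit : ∀ r q → r < 6 → eval (digit r q) ℤ.+ + 2 ≡ + 6 ℤ.* eval q ℤ.+ + r
eval-digit 0 q _ = identity (eval q)
  where
  identity : ∀ x → + 2 ℤ.* (+ 3 ℤ.* x ℤ.- + 1) ℤ.+ + 2 ≡ + 6 ℤ.* x ℤ.+ + 0
  identity = ℤSolver.solve-∀
eval-digit 1 q _ = identity (eval q)
  where
  identity : ∀ x → + 2 ℤ.* (+ 3 ℤ.* x) ℤ.- + 1 ℤ.+ + 2 ≡ + 6 ℤ.* x ℤ.+ + 1
  identity = ℤSolver.solve-∀
eval-digit 2 q _ = identity (eval q)
  where
  identity : ∀ x → + 2 ℤ.* (+ 3 ℤ.* x) ℤ.+ + 2 ≡ + 6 ℤ.* x ℤ.+ + 2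
  identity = ℤSolver.solve-∀
eval-digit 3 q _ = identity (eval q)
  where
  identity : ∀ x → + 2 ℤ.* (+ 3 ℤ.* x) ℤ.+ + 1 ℤ.+ + 2 ≡ + 6 ℤ.* x ℤ.+ + 3
  identity = ℤSolver.solve-∀
eval-digit 4 q _ = identity (eval q)
  where
  identity : ∀ x → + 2 ℤ.* (+ 3 ℤ.* x ℤ.+ + 1) ℤ.+ + 2 ≡ + 6 ℤ.* x ℤ.+ + 4
  identity = ℤSolver.solve-∀
eval-digit 5 q _ = identity (eval q)
  where
  identity : ∀ x → + 3 ℤ.* (+ 2 ℤ.* x ℤ.+ + 1) ℤ.+ + 2 ≡ + 6 ℤ.* x ℤ.+ + 5
  identity = ℤSolver.solve-∀
eval-digit (suc (suc (suc (suc (suc (suc _)))))) q (s≤s (s≤s (s≤s (s≤s (s≤s (s≤s ()))))))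

bound-step : ∀ {A B M E x y k k'} → M * 6 ≡ E → k ≤ 6 + k' → 6 * x ≤ y →
             A * 6 ^ (M * k') ≤ x ^ E * B → A * 6 ^ (M * k) ≤ y ^ E * B
bound-step {A} {B} {M} {x = x} {y} {k} {k'} refl k≤ 6x≤y h = begin
  A * 6 ^ (M * k)                   ≤⟨ *-monoʳ-≤ A (^-monoʳ-≤ 6 (*-monoʳ-≤ M k≤)) ⟩
  A * 6 ^ (M * (6 + k'))            ≡⟨ cong (λ z → A * 6 ^ z) (*-distribˡ-+ M 6 k') ⟩
  A * 6 ^ (M * 6 + M * k')          ≡⟨ cong (A *_) (^-distribˡ-+-* 6 (M * 6) (M * k')) ⟩
  A * (6 ^ (M * 6) * 6 ^ (M * k'))  ≡⟨ left-swap A (6 ^ (M * 6)) (6 ^ (M * k')) ⟩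
  6 ^ (M * 6) * (A * 6 ^ (M * k'))  ≤⟨ *-monoʳ-≤ (6 ^ (M * 6)) h ⟩
  6 ^ (M * 6) * (x ^ (M * 6) * B)   ≡⟨ *-assoc (6 ^ (M * 6)) _ B ⟨
  6 ^ (M * 6) * x ^ (M * 6) * B     ≡⟨ cong (_* B) (^-distribʳ-* 6 x (M * 6)) ⟨
  (6 * x) ^ (M * 6) * B             ≤⟨ *-monoˡ-≤ B (^-monoˡ-≤ (M * 6) 6x≤y) ⟩
  y ^ (M * 6) * B                   ∎
  where
  open ≤-Reasoning
  left-swap : ∀ a b c → a * (b * c) ≡ b * (a * c)
  left-swap = solve-∀

-- E = 6 M is a separate parameter so that instances keep a literal exponent:
-- unifying n ^ (1000 * 6) with n ^ 6000 would unfold the power.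
module Construction (M E B : ℕ) (M*6≡E : M * 6 ≡ E) where

  -- For the value n = 1 + p, the weight 3 + 5 p = 5 n − 2 grows by exactly
  -- the factor 6 in the worst step n ↦ 6 n − 2.
  Bound : ℕ → ℕ → Set
  Bound p k = 5 ^ E * 6 ^ (M * k) ≤ (3 + 5 * p) ^ E * B

  Representable : ℕ → Set
  Representable p = ∃[ e ] eval e ≡ + suc p × Bound p (ones e)

  representable-digit : ∀ r q → r < 6 → Representable q → Representable (3 + r + q * 6)
  representable-digit r q r<6 (e , eval≡ , bound) =
    digit r e , value , bound-step {A = 5 ^ E} {B = B} {M = M} {x = 3 + 5 * q} M*6≡E (ones-digit r e) weight bound
    where
    weight-expand : ∀ r q → 3 + 5 * (3 + r + q * 6) ≡ 6 * (3 + 5 * q) + 5 * r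
    weight-expand = solve-∀
    weight : 6 * (3 + 5 * q) ≤ 3 + 5 * (3 + r + q * 6)
    weight = subst (6 * (3 + 5 * q) ≤_) (sym (weight-expand r q)) (m≤m+n _ _)
    value-expand : ∀ r q → 6 * suc q + r ≡ suc (3 + r + q * 6) + 2
    value-expand = solve-∀
    value : eval (digit r e) ≡ + suc (3 + r + q * 6)
    value = ∙-cancelʳ (+ 2) _ _ (begin
      eval (digit r e) ℤ.+ + 2       ≡⟨ eval-digit r e r<6 ⟩
      + 6 ℤ.* eval e ℤ.+ + r        ≡⟨ cong (λ v → + 6 ℤ.* v ℤ.+ + r) eval≡ ⟩
      + (6 * suc q + r)             ≡⟨ cong +_ (value-expand r q) ⟩
      + (suc (3 + r + q * 6) + 2)   ∎)
      where open ≡-Reasoning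

  representable : Bound 0 1 → Bound 1 2 → Bound 2 3 → ∀ p → Representable p
  representable bound₁ bound₂ bound₃ = <-rec Representable go
    where
    go : ∀ p → (∀ {q} → q < p → Representable q) → Representable p
    go 0 _ = one , refl , bound₁
    go 1 _ = two , refl , bound₂
    go 2 _ = three , refl , bound₃
    go (suc (suc (suc t))) rec =
      subst (λ p → Representable (3 + p)) (sym (m≡m%n+[m/n]*n t 6))
        (representable-digit (t % 6) (t / 6) (m%n<n t 6) (rec (s≤s (≤-trans (m/n≤m t 6) (m≤n+m t 2)))))

  Bound⇒6^≤ : ∀ {p k k'} → k ≤ k' → Bound p k' → 6 ^ (M * k) ≤ suc p ^ E * B
  Bound⇒6^≤ {p} {k} {k'} k≤k' bound = *-cancelˡ-≤ (5 ^ E) {{m^n≢0 5 E}} (begin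
    5 ^ E * 6 ^ (M * k)        ≤⟨ *-monoʳ-≤ (5 ^ E) (^-monoʳ-≤ 6 (*-monoʳ-≤ M k≤k')) ⟩
    5 ^ E * 6 ^ (M * k')       ≤⟨ bound ⟩
    (3 + 5 * p) ^ E * B        ≤⟨ *-monoˡ-≤ B (^-monoˡ-≤ E weight≤) ⟩
    (5 * suc p) ^ E * B        ≡⟨ cong (_* B) (^-distribʳ-* 5 (suc p) E) ⟩
    5 ^ E * suc p ^ E * B ≡⟨ *-assoc (5 ^ E) _ B ⟩
    5 ^ E * (suc p ^ E * B) ∎)
    where
    open ≤-Reasoning
    weight≤ : 3 + 5 * p ≤ 5 * suc p
    weight≤ = subst (3 + 5 * p ≤_) (sym (*-suc 5 p)) (+-monoˡ-≤ (5 * p) {3} {5} (s≤s (s≤s (s≤s z≤n))))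

three^suc : ℕ → Expr
three^suc zero = three
three^suc (suc m) = three ⊗ three^suc m

eval-three^suc : ∀ m → eval (three^suc m) ≡ + 3 ^ suc m
eval-three^suc zero = refl
eval-three^suc (suc m) rewrite eval-three^suc m = sym (ℤP.pos-* 3 (3 ^ suc m))

ones-three^suc : ∀ m → ones (three^suc m) ≡ 3 * suc m
ones-three^suc zero = refl
ones-three^suc (suc m) rewrite ones-three^suc m = sym (*-suc 3 (suc m))

IsNorm⇒cube≤ : ∀ {n k} → IsNorm n k → n ^ 3 ≤ 3 ^ k
IsNorm⇒cube≤ ((e , eval≡n , ones≡k) , _) =
  subst₂ (λ v o → ∣ v ∣ ^ 3 ≤ 3 ^ o) eval≡n ones≡k (∣eval∣-cube-≤ e)

IsNorm-3^suc : ∀ {m k} → IsNorm (3 ^ suc m) k → k ≡ 3 * suc m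
IsNorm-3^suc {m} {k} norm@(_ , minimal) = ≤-antisym upper lower
  where
  upper : k ≤ 3 * suc m
  upper = subst (k ≤_) (ones-three^suc m) (minimal (three^suc m) (eval-three^suc m))
  lower : 3 * suc m ≤ k
  lower = ≮⇒≥ λ k<3m → <-irrefl refl (<-≤-trans
    (^-monoʳ-< 3 (s≤s (s≤s z≤n)) (subst (k <_) (*-comm 3 (suc m)) k<3m))
    (subst (_≤ 3 ^ k) (^-*-assoc 3 (suc m) 3) (IsNorm⇒cube≤ norm)))

IsNorm-power-of-3 : ∀ {n k} → 1 < n → IsNorm n k → (m : ℕ) → n ≡ 3 ^ m → k ≡ 3 * m
IsNorm-power-of-3 1<1 _ zero refl = ⊥-elim (<-irrefl refl 1<1)
IsNorm-power-of-3 _ norm (suc m) refl = IsNorm-3^suc norm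

IsNorm⇒cube< : ∀ {n k} → IsNorm n k → ¬ (∃[ m ] n ≡ 3 ^ m) → n ^ 3 < 3 ^ k
IsNorm⇒cube< {n} {k} norm not-power =
  ≤∧≢⇒< (IsNorm⇒cube≤ norm) (λ n³≡3^k → not-power (cube≡3^⇒≡3^ k n n³≡3^k))

open Construction 1000 6000 (6 ^ 5890) refl

all-representable : ∀ p → Representable p
all-representable = representable (toWitness {a? = _ ≤? _} tt) (toWitness {a? = _ ≤? _} tt) (toWitness {a? = _ ≤? _} tt)

IsNorm⇒6^≤ : ∀ {p k} → IsNorm (suc p) k → 6 ^ (1000 * k) ≤ suc p ^ 6000 * 6 ^ 5890
IsNorm⇒6^≤ {p} {k} (_ , minimal) =
  -- implicit arguments are passed explicitly so that no power gets unfolded during unification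
  let (w , eval≡n , bound) = all-representable p
  in Bound⇒6^≤ {p} {k} {ones w} (minimal w eval≡n) bound

theorem2 : (n : ℕ) → 1 < n →
    Σ ℕ (λ k → IsNorm n k
      -- 3 log₃ n ≤ ‖n‖₋
      × n ^ 3 ≤ 3 ^ k
      -- ‖n‖₋ ≤ 6 log₆ n + 5.890   (⟺ 6^(1000k) ≤ n^6000 · 6^5890)
      × 6 ^ (1000 * k) ≤ n ^ 6000 * 6 ^ 5890
      -- 6 log₆ n + 5.890 < 3.679 log₃ n + 5.890   (for n > 1, ⟺ 3^6000 < 6^3679)
      × 3 ^ 6000 < 6 ^ 3679
      -- if n = 3^m then ‖n‖₋ = 3 log₃ n = 3m
      × ((m : ℕ) → n ≡ 3 ^ m → k ≡ 3 * m)
      -- otherwise ‖n‖₋ > 3 log₃ n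
      × (¬ Σ ℕ (λ m → n ≡ 3 ^ m) → n ^ 3 < 3 ^ k))
theorem2 zero ()
theorem2 (suc p) 1<n =
  let (w , eval≡n , _) = all-representable p
      (k , norm) = norm-exists (suc p) w eval≡n
  in k , norm , IsNorm⇒cube≤ norm , IsNorm⇒6^≤ {p} {k} norm , toWitness {a? = suc (3 ^ 6000) ≤? 6 ^ 3679} tt ,
     IsNorm-power-of-3 1<n norm , IsNorm⇒cube< norm
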